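{- Let $S$ be a set of sorts, $A$ an $S$-sorted set, $J$ a many-sorted closure operator on $A$, and $n\in\mathbb{N}$. Then $J$ is $n$-ary if, and only if, for every $X\subseteq A$: if $J(Z)\subseteq X$ for every $Z\in\mathrm{Sub}_{\leq n}(X)$, then $J(X)=X$.
   Context: An $S$-sorted set is a family $A=(A_s)_{s\in S}$ of sets. For $S$-sorted sets $X,Y$, $X\subseteq Y$ means $X_s\subseteq Y_s$ for all $s$; unions are sortwise; $\mathrm{Sub}(A)$ is the set of all $S$-sorted $X\subseteq A$. The cardinal $\mathrm{card}(X)$ is the cardinal of $\bigcup_{s\in S}(X_s\times\{s\})$, and $\mathrm{Sub}_{\leq n}(X)=\{Y\subseteq X\mid\mathrm{card}(Y)\leq n\}$. A many-sorted closure operator on $A$ is a map $J:\mathrm{Sub}(A)\to\mathrm{Sub}(A)$ that is extensive ($X\subseteq J(X)$), isotone and idempotent. For $n\in\mathbb{N}$ define $J_{\leq n}(X)=\bigcup\{J(Y)\mid Y\in\mathrm{Sub}_{\leq n}(X)\}$, $J^0_{\leq n}=\mathrm{Id}_{\mathrm{Sub}(A)}$, $J^{k+1}_{\leq n}=J_{\leq n}\circ J^k_{\leq n}$, and $J^\omega_{\leq n}(X)=\bigcup_{m\in\mathbb{N}}J^m_{\leq n}(X)$; $J$ is $n$-ary if $J=J^\omega_{\leq n}$. -}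

module Defs where

open import Data.Nat using (ℕ; zero; suc; _≤_)
open import Data.Fin using (Fin)
open import Data.Product using (Σ; Σ-syntax; ∃; ∃-syntax; _×_; _,_; proj₁; proj₂)
open import Relation.Binary.PropositionalEquality using (_≡_)

Sub : {S : Set} → (S → Set) → Set₁
Sub {S} A = (s : S) → A s → Set

_⊆_ : {S : Set} {A : S → Set} → Sub A → Sub A → Set
_⊆_ {S} {A} X Y = (s : S) (a : A s) → X s a → Y s a

_≐_ : {S : Set} {A : S → Set} → Sub A → Sub A → Set
X ≐ Y = (X ⊆ Y) × (Y ⊆ X)

Elt : {S : Set} → (S → Set) → Set
Elt {S} A = Σ[ s ∈ S ] A s

Img : {S : Set} {A : S → Set} {k : ℕ} → (Fin k → Elt A) → Sub A
Img {S} {A} {k} f s a = Σ[ i ∈ Fin k ] (f i ≡ (s , a))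

-- card(Y) ≤ n : the disjoint union ⋃ₛ (Yₛ × {s}) is enumerated by some Fin k with k ≤ n,
-- i.e. Y is the image of a family indexed by Fin k, k ≤ n.
CardLe : {S : Set} {A : S → Set} → Sub A → ℕ → Set
CardLe {S} {A} Y n = Σ[ k ∈ ℕ ] (k ≤ n × Σ[ f ∈ (Fin k → Elt A) ] (Img f ≐ Y))

InSubLe : {S : Set} {A : S → Set} → ℕ → Sub A → Sub A → Set
InSubLe n X Y = (Y ⊆ X) × CardLe Y n

record IsClosure {S : Set} {A : S → Set} (J : Sub A → Sub A) : Set₁ where
  field
    extensive  : (X : Sub A) → X ⊆ J X
    isotone    : (X Y : Sub A) → X ⊆ Y → J X ⊆ J Y
    idempotent : (X : Sub A) → J (J X) ≐ J X

-- J_{≤n}(X) = ⋃ { J(Y) | Y ∈ Sub_{≤n}(X) }.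
-- For predicativity the union ranges over finite enumerations f : Fin k → Elt A (k ≤ n)
-- with Img f ⊆ X; every Y ∈ Sub_{≤n}(X) is (extensionally) of the form Img f.
Jle : {S : Set} {A : S → Set} → (Sub A → Sub A) → ℕ → Sub A → Sub A
Jle {S} {A} J n X s a =
  Σ[ k ∈ ℕ ] (k ≤ n × Σ[ f ∈ (Fin k → Elt A) ] ((Img f ⊆ X) × J (Img f) s a))

Jpow : {S : Set} {A : S → Set} → (Sub A → Sub A) → ℕ → ℕ → Sub A → Sub A
Jpow J n zero    X = X
Jpow J n (suc m) X = Jle J n (Jpow J n m X)

Jω : {S : Set} {A : S → Set} → (Sub A → Sub A) → ℕ → Sub A → Sub A
Jω J n X s a = ∃[ m ] Jpow J n m X s a

IsNAry : {S : Set} {A : S → Set} → (Sub A → Sub A) → ℕ → Set₁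
IsNAry {A = A} J n = (X : Sub A) → J X ≐ Jω J n X

-- J^ω_{≤n}(X) always lies between X and J(X), and it is closed under J on subsets of
-- cardinality ≤ n: finitely many (≤ n) elements of the union already lie in a common stage
-- J^M_{≤n}(X), so their closure lies in J^{M+1}_{≤n}(X).  Hence if every set closed under
-- small subsets is J-closed, J(X) ⊆ J(J^ω_{≤n}(X)) = J^ω_{≤n}(X).  Conversely, if X is
-- closed under small subsets, every stage J^m_{≤n}(X) stays inside X, so J(X) ⊆ X.
module Submission where

open import Defs
open import Data.Nat using (ℕ; zero; suc; _≤_; z≤n; s≤s; _⊔_)
open import Data.Nat.Properties using (≤-trans; n≤1+n; m≤m⊔n; m≤n⊔m)
open import Data.Fin using (Fin; zero; suc)
open import Data.Product using (_×_; _,_; proj₁; proj₂; ∃)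
open import Relation.Binary.PropositionalEquality using (refl)

module _ {S : Set} {A : S → Set} where

  _∈_ : Elt A → Sub A → Set
  (s , a) ∈ X = X s a

  ⊆-trans : {X Y Z : Sub A} → X ⊆ Y → Y ⊆ Z → X ⊆ Z
  ⊆-trans X⊆Y Y⊆Z s a x = Y⊆Z s a (X⊆Y s a x)

  Img-⊆ : {k : ℕ} {f : Fin k → Elt A} {X : Sub A} → ((i : Fin k) → f i ∈ X) → Img f ⊆ X
  Img-⊆ f⊆X s a (i , refl) = f⊆X i

  Img-∋ : {k : ℕ} (f : Fin k → Elt A) (i : Fin k) → f i ∈ Img f
  Img-∋ f i = i , refl

module _ {S : Set} {A : S → Set} (J : Sub A → Sub A) (n : ℕ) where

  ClosedUnderSmall : Sub A → Set₁
  ClosedUnderSmall X = (Z : Sub A) → InSubLe n X Z → J Z ⊆ X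

  Jle-monotone : {X Y : Sub A} → X ⊆ Y → Jle J n X ⊆ Jle J n Y
  Jle-monotone X⊆Y s a (k , k≤n , f , f⊆X , j) = k , k≤n , f , ⊆-trans f⊆X X⊆Y , j

  Jpow-⊆-closed : {X : Sub A} → ClosedUnderSmall X → (m : ℕ) → Jpow J n m X ⊆ X
  Jpow-⊆-closed closed zero s a x = x
  Jpow-⊆-closed closed (suc m) s a (k , k≤n , f , f⊆stage , j) =
    closed (Img f) (⊆-trans f⊆stage (Jpow-⊆-closed closed m) , k , k≤n , f , (λ _ _ p → p) , (λ _ _ p → p)) s a j

  ⊆-Jω : (X : Sub A) → X ⊆ Jω J n X
  ⊆-Jω X s a x = 0 , x

  Jω-⊆-closed : {X : Sub A} → ClosedUnderSmall X → Jω J n X ⊆ X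
  Jω-⊆-closed closed s a (m , x) = Jpow-⊆-closed closed m s a x

  module _ (closure : IsClosure J) where
    open IsClosure closure

    Jle-extensive : 1 ≤ n → (X : Sub A) → X ⊆ Jle J n X
    Jle-extensive 1≤n X s a x = 1 , 1≤n , (λ _ → s , a) , Img-⊆ (λ _ → x) , extensive _ s a (Img-∋ _ zero)

    Jpow-monotone : 1 ≤ n → (X : Sub A) {m m′ : ℕ} → m ≤ m′ → Jpow J n m X ⊆ Jpow J n m′ X
    Jpow-monotone 1≤n X {m′ = zero}   z≤n      = λ _ _ x → x
    Jpow-monotone 1≤n X {m′ = suc m′} z≤n      =
      ⊆-trans (Jpow-monotone 1≤n X {m′ = m′} z≤n) (Jle-extensive 1≤n _)
    Jpow-monotone 1≤n X               (s≤s m≤m′) = Jle-monotone (Jpow-monotone 1≤n X m≤m′)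

    -- k ≤ n is only used to get 1 ≤ n (needed to merge stages) when k > 0.
    Jω-family-in-stage : (X : Sub A) (k : ℕ) → k ≤ n → (f : Fin k → Elt A) →
      ((i : Fin k) → f i ∈ Jω J n X) → ∃ λ M → (i : Fin k) → f i ∈ Jpow J n M X
    Jω-family-in-stage X zero    _   f f⊆Jω = 0 , λ ()
    Jω-family-in-stage X (suc k) k≤n f f⊆Jω
      with f⊆Jω zero | Jω-family-in-stage X k (≤-trans (n≤1+n k) k≤n) (λ i → f (suc i)) (λ i → f⊆Jω (suc i))
    ... | m₀ , f₀ | M , fₛ = m₀ ⊔ M , λ where
        zero    → Jpow-monotone 1≤n X (m≤m⊔n m₀ M) _ _ f₀
        (suc i) → Jpow-monotone 1≤n X (m≤n⊔m m₀ M) _ _ (fₛ i)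
      where
      1≤n : 1 ≤ n
      1≤n = ≤-trans (s≤s z≤n) k≤n

    Jω-closedUnderSmall : (X : Sub A) → ClosedUnderSmall (Jω J n X)
    Jω-closedUnderSmall X Z (Z⊆Jω , k , k≤n , f , f⊆Z , Z⊆f)
      with Jω-family-in-stage X k k≤n f (λ i → Z⊆Jω _ _ (f⊆Z _ _ (Img-∋ f i)))
    ... | M , f⊆stage = λ s a j → suc M , k , k≤n , f , Img-⊆ f⊆stage , isotone Z (Img f) Z⊆f s a j

    Jpow-⊆-J : (X : Sub A) (m : ℕ) → Jpow J n m X ⊆ J X
    Jpow-⊆-J X zero = extensive X
    Jpow-⊆-J X (suc m) s a (k , k≤n , f , f⊆stage , j) =
      proj₁ (idempotent X) s a (isotone (Img f) (J X) (⊆-trans f⊆stage (Jpow-⊆-J X m)) s a j)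

    Jω-⊆-J : (X : Sub A) → Jω J n X ⊆ J X
    Jω-⊆-J X s a (m , x) = Jpow-⊆-J X m s a x

proposition2p12 : (S : Set) (A : S → Set) (J : Sub A → Sub A) → IsClosure J → (n : ℕ) →
    (IsNAry J n → (X : Sub A) → ((Z : Sub A) → InSubLe n X Z → J Z ⊆ X) → J X ≐ X)
    × (((X : Sub A) → ((Z : Sub A) → InSubLe n X Z → J Z ⊆ X) → J X ≐ X) → IsNAry J n)
proposition2p12 S A J closure n = nAry⇒closed , closed⇒nAry
  where
  open IsClosure closure

  nAry⇒closed : IsNAry J n → (X : Sub A) → ClosedUnderSmall J n X → J X ≐ X
  nAry⇒closed nAry X closed = ⊆-trans (proj₁ (nAry X)) (Jω-⊆-closed J n closed) , extensive X

  closed⇒nAry : ((X : Sub A) → ClosedUnderSmall J n X → J X ≐ X) → IsNAry J n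
  closed⇒nAry H X = J⊆Jω , Jω-⊆-J J n closure X
    where
    J⊆Jω : J X ⊆ Jω J n X
    J⊆Jω = ⊆-trans (isotone X (Jω J n X) (⊆-Jω J n X))
                   (proj₁ (H (Jω J n X) (Jω-closedUnderSmall J n closure X)))
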